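{- Let $k\ge 2$ and $p_1,\dots,p_k\ge 1$, and let $K_{p_1,\dots,p_k}$ be the complete $k$-partite graph with parts of sizes $p_1,\dots,p_k$. Then $\mathrm{MEG}(K_{p_1,\dots,p_k})=|V(K_{p_1,\dots,p_k})|=p_1+\dots+p_k$, except when the graph is a star $K_{1,p}$ with $p\ge 2$ (i.e. $k=2$ and one part has size $1$ while the other has size $p\ge 2$), in which case $\mathrm{MEG}(K_{1,p})=p$.
   Context: The complete $k$-partite graph $K_{p_1,\dots,p_k}$ has $k$ disjoint vertex sets of sizes $p_1,\dots,p_k$, with an edge between any two vertices in distinct sets and no other edges. Two vertices $x,y$ of a graph $G$ monitor an edge $e$ if $e$ belongs to all shortest paths between $x$ and $y$. A set $S\subseteq V(G)$ is a monitoring edge-geodetic set (MEG-set) if for every edge $e$ of $G$ there is a pair $x,y\in S$ that monitors $e$. $\mathrm{MEG}(G)$ denotes the minimum size of an MEG-set of $G$. -}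

module Defs where

open import Level using (0ℓ)
open import Data.Nat using (ℕ; zero; suc; _≤_)
open import Data.Fin using (Fin)
open import Data.Product using (Σ; _×_; _,_; ∃-syntax; proj₁)
open import Data.Sum using (_⊎_)
open import Data.List using (List; length; tabulate)
open import Data.Nat.ListAction using (sum)
open import Data.List.Membership.Propositional using (_∈_)
open import Data.List.Relation.Unary.Unique.Propositional using (Unique)
open import Relation.Binary.PropositionalEquality using (_≡_; _≢_)

record Graph : Set₁ where
  field
    V   : Set
    Adj : V → V → Set

module _ (G : Graph) where
  open Graph G

  data Walk : V → V → Set where
    [] : ∀ {x} → Walk x x
    step : ∀ {x y z} → Adj x y → Walk y z → Walk x z

  len : ∀ {x y} → Walk x y → ℕ
  len []         = 0
  len (step _ w) = suc (len w)

  data EdgeOn (u v : V) : ∀ {x y} → Walk x y → Set where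
    here  : ∀ {z} {a : Adj u v} {w : Walk v z} → EdgeOn u v (step a w)
    here' : ∀ {z} {a : Adj v u} {w : Walk u z} → EdgeOn u v (step a w)
    there : ∀ {x y z} {a : Adj x y} {w : Walk y z} → EdgeOn u v w → EdgeOn u v (step a w)

  IsShortest : ∀ {x y} → Walk x y → Set
  IsShortest {x} {y} w = ∀ (w' : Walk x y) → len w ≤ len w'

  Monitors : V → V → V → V → Set
  Monitors x y u v = ∀ (w : Walk x y) → IsShortest w → EdgeOn u v w

  -- A monitoring edge-geodetic set, given as a duplicate-free list of vertices.
  IsMEGSet : List V → Set
  IsMEGSet S = ∀ u v → Adj u v → ∃[ x ] ∃[ y ] (x ∈ S × y ∈ S × Monitors x y u v)

  MEGIs : ℕ → Set
  MEGIs m = (∃[ S ] (Unique S × IsMEGSet S × length S ≡ m))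
          × (∀ S → Unique S → IsMEGSet S → m ≤ length S)

CompleteMultipartite : (k : ℕ) → (Fin k → ℕ) → Graph
CompleteMultipartite k p = record
  { V   = Σ (Fin k) (λ i → Fin (p i))
  ; Adj = λ u v → proj₁ u ≢ proj₁ v }

total : (k : ℕ) → (Fin k → ℕ) → ℕ
total k p = sum (tabulate p)

IsStar : (k : ℕ) → (Fin k → ℕ) → Set
IsStar k p = ∃[ i ] ∃[ j ] (i ≢ j × p i ≡ 1 × 2 ≤ p j × (∀ l → l ≡ i ⊎ l ≡ j))

module Submission where

-- If x, y monitor an edge uv with u ∉ {x, y}, then x and y are non-adjacent (else the edge xy is
-- their only geodesic), hence distinct vertices of one part, and every vertex outside that part is
-- a common neighbour of x and y, i.e. the midpoint of a geodesic; so u is the only vertex outside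
-- the part and the graph is a star centred at u. Hence outside the star case every vertex lies in
-- every MEG-set, while the whole vertex set is one since each edge is monitored by its endpoints.
-- In the star K_{1,q} the centre part has one vertex, so every leaf is forced, and any two leaves
-- have the centre as unique common neighbour and thus monitor both edges through it.

open import Defs
open import Axiom.UniquenessOfIdentityProofs using (module Decidable⇒UIP)
open import Data.Nat using (ℕ; zero; suc; _+_; _≤_; z≤n; s≤s)
open import Data.Nat.Properties using (≤-antisym; <-irrefl)
open import Data.Nat.ListAction using (sum)
open import Data.Fin using (Fin; fromℕ<; punchIn) renaming (zero to fzero; suc to fsuc)
open import Data.Fin.Properties using (_≟_; punchInᵢ≢i)
open import Data.Product using (_×_; _,_; proj₁; ∃-syntax)
open import Data.Product.Properties using (,-injectiveˡ; ,-injectiveʳ-UIP; ≡-dec)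
open import Data.Sum using (_⊎_; inj₁; inj₂)
open import Data.Empty using (⊥-elim)
open import Data.List using (List; []; _∷_; length; map; concat; tabulate; allFin)
open import Data.List.Properties using (length-++; length-map; length-tabulate; map-tabulate; tabulate-cong)
open import Data.List.Membership.Propositional using (_∈_)
open import Data.List.Membership.Propositional.Properties using (∈-map⁺; ∈-map⁻; ∈-allFin; ∈-tabulate⁺; ∈-concat⁺′)
open import Data.List.Relation.Unary.Any using (here; there)
import Data.List.Relation.Unary.All as All
import Data.List.Relation.Unary.All.Properties as All
import Data.List.Relation.Unary.AllPairs.Properties as AllPairs
open import Data.List.Relation.Unary.AllPairs using (_∷_)
open import Data.List.Relation.Binary.Disjoint.Propositional using (Disjoint)
open import Data.List.Relation.Binary.Subset.Propositional using (_⊆_)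
open import Data.List.Relation.Unary.Unique.Propositional using (Unique)
import Data.List.Relation.Unary.Unique.Propositional.Properties as Unique
open import Function using (_∘_)
open import Relation.Nullary using (¬_; yes; no)
open import Relation.Nullary.Decidable using (decidable-stable)
open import Relation.Binary.PropositionalEquality
  using (_≡_; _≢_; refl; sym; trans; cong; subst; module ≡-Reasoning)

module _ {A : Set} where

  remove : ∀ {x : A} (xs : List A) → x ∈ xs → List A
  remove (_ ∷ xs) (here _)     = xs
  remove (y ∷ xs) (there x∈xs) = y ∷ remove xs x∈xs

  length-remove : ∀ {x : A} (xs : List A) (x∈xs : x ∈ xs) →
                  suc (length (remove xs x∈xs)) ≡ length xs
  length-remove (_ ∷ xs) (here _)     = refl
  length-remove (_ ∷ xs) (there x∈xs) = cong suc (length-remove xs x∈xs)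

  ∈-remove : ∀ {x y : A} (xs : List A) (x∈xs : x ∈ xs) →
             y ∈ xs → x ≢ y → y ∈ remove xs x∈xs
  ∈-remove (_ ∷ xs) (here refl)  (here refl)  x≢y = ⊥-elim (x≢y refl)
  ∈-remove (_ ∷ xs) (here refl)  (there y∈xs) x≢y = y∈xs
  ∈-remove (_ ∷ xs) (there x∈xs) (here refl)  x≢y = here refl
  ∈-remove (_ ∷ xs) (there x∈xs) (there y∈xs) x≢y = there (∈-remove xs x∈xs y∈xs x≢y)

  Unique-⊆⇒length≤ : ∀ {xs ys : List A} → Unique xs → xs ⊆ ys → length xs ≤ length ys
  Unique-⊆⇒length≤ {[]}     _                 _     = z≤n
  Unique-⊆⇒length≤ {x ∷ xs} {ys} (x∉xs ∷ xs!) xs⊆ys =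
    subst (suc (length xs) ≤_) (length-remove ys x∈ys)
      (s≤s (Unique-⊆⇒length≤ xs! λ y∈xs →
        ∈-remove ys x∈ys (xs⊆ys (there y∈xs)) (All.lookup x∉xs y∈xs)))
    where x∈ys = xs⊆ys (here refl)

  length-concat : (xss : List (List A)) → length (concat xss) ≡ sum (map length xss)
  length-concat []         = refl
  length-concat (xs ∷ xss) = trans (length-++ xs) (cong (length xs +_) (length-concat xss))

module _ (G : Graph) where
  open Graph G

  edgeOn-sym : ∀ {u v x y} {w : Walk G x y} → EdgeOn G u v w → EdgeOn G v u w
  edgeOn-sym here      = here'
  edgeOn-sym here'     = here
  edgeOn-sym (there e) = there (edgeOn-sym e)

  monitors-sym : ∀ {x y u v} → Monitors G x y u v → Monitors G x y v u
  monitors-sym mon w w-shortest = edgeOn-sym (mon w w-shortest)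

  edgeOn-edge : ∀ {u v x y} {a : Adj x y} → EdgeOn G u v (step a []) → u ≡ x ⊎ u ≡ y
  edgeOn-edge here  = inj₁ refl
  edgeOn-edge here' = inj₂ refl

  edgeOn-path₂ : ∀ {u v x m y} {a : Adj x m} {b : Adj m y} →
                 EdgeOn G u v (step a (step b [])) → u ≡ x ⊎ u ≡ m ⊎ u ≡ y
  edgeOn-path₂ here          = inj₁ refl
  edgeOn-path₂ here'         = inj₂ (inj₁ refl)
  edgeOn-path₂ (there here)  = inj₂ (inj₁ refl)
  edgeOn-path₂ (there here') = inj₂ (inj₂ refl)

  edge-isShortest : ∀ {x y} → x ≢ y → (a : Adj x y) → IsShortest G (step a [])
  edge-isShortest x≢y a []         = ⊥-elim (x≢y refl)
  edge-isShortest x≢y a (step _ _) = s≤s z≤n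

  path₂-isShortest : ∀ {x m y} → x ≢ y → ¬ Adj x y → (a : Adj x m) (b : Adj m y) →
                     IsShortest G (step a (step b []))
  path₂-isShortest x≢y ¬x~y a b []                  = ⊥-elim (x≢y refl)
  path₂-isShortest x≢y ¬x~y a b (step x~y [])       = ⊥-elim (¬x~y x~y)
  path₂-isShortest x≢y ¬x~y a b (step _ (step _ _)) = s≤s (s≤s z≤n)

  monitors⇒≢ : ∀ {x y u v} → Monitors G x y u v → x ≢ y
  monitors⇒≢ mon refl with mon [] (λ _ → z≤n)
  ... | ()

  monitors-inner-vertex : ∀ {x y u v} → Monitors G x y u v → u ≢ x → u ≢ y →
                          x ≢ y × ¬ Adj x y × (∀ m → Adj x m → Adj m y → u ≡ m)
  monitors-inner-vertex {x} {y} {u} mon u≢x u≢y = x≢y , ¬x~y , middle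
    where
    x≢y = monitors⇒≢ mon

    ¬x~y : ¬ Adj x y
    ¬x~y x~y with edgeOn-edge (mon (step x~y []) (edge-isShortest x≢y x~y))
    ... | inj₁ u≡x = u≢x u≡x
    ... | inj₂ u≡y = u≢y u≡y

    middle : ∀ m → Adj x m → Adj m y → u ≡ m
    middle m x~m m~y
      with edgeOn-path₂ (mon (step x~m (step m~y [])) (path₂-isShortest x≢y ¬x~y x~m m~y))
    ... | inj₁ u≡x        = ⊥-elim (u≢x u≡x)
    ... | inj₂ (inj₁ u≡m) = u≡m
    ... | inj₂ (inj₂ u≡y) = ⊥-elim (u≢y u≡y)

  adjacent-monitors : (∀ x → ¬ Adj x x) → ∀ {u v} → Adj u v → Monitors G u v u v
  adjacent-monitors irrefl u~v []                  _          = ⊥-elim (irrefl _ u~v)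
  adjacent-monitors irrefl u~v (step _ [])         _          = here
  adjacent-monitors irrefl u~v (step _ (step _ _)) w-shortest with w-shortest (step u~v [])
  ... | s≤s ()

  unique-common-neighbour-monitors :
    ∀ {x m y} → x ≢ y → ¬ Adj x y → Adj x m → Adj m y →
    (∀ m′ → Adj x m′ → Adj m′ y → m′ ≡ m) → Monitors G x y x m
  unique-common-neighbour-monitors x≢y ¬x~y x~m m~y unique [] _ = ⊥-elim (x≢y refl)
  unique-common-neighbour-monitors x≢y ¬x~y x~m m~y unique (step x~y []) _ = ⊥-elim (¬x~y x~y)
  unique-common-neighbour-monitors x≢y ¬x~y x~m m~y unique (step {y = m′} x~m′ (step m′~y [])) _
    with unique m′ x~m′ m′~y
  ... | refl = here
  unique-common-neighbour-monitors x≢y ¬x~y x~m m~y unique (step _ (step _ (step _ _))) w-shortest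
    with w-shortest (step x~m (step m~y []))
  ... | s≤s (s≤s ())

  complete-IsMEGSet : (∀ x → ¬ Adj x x) → ∀ {vs} → (∀ v → v ∈ vs) → IsMEGSet G vs
  complete-IsMEGSet irrefl ∈vs u v u~v = u , v , ∈vs u , ∈vs v , adjacent-monitors irrefl u~v

  ⊆-every-MEGSet⇒MEGIs : ∀ {xs} → Unique xs → IsMEGSet G xs →
                          (∀ S → IsMEGSet G S → xs ⊆ S) → MEGIs G (length xs)
  ⊆-every-MEGSet⇒MEGIs xs! xs-meg forced =
    (_ , xs! , xs-meg , refl) , λ S _ S-meg → Unique-⊆⇒length≤ xs! (forced S S-meg)

another : ∀ {n} → 2 ≤ n → (a : Fin n) → ∃[ b ] b ≢ a
another (s≤s (s≤s _)) a = punchIn a fzero , punchInᵢ≢i a fzero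

distinct⇒2≤ : ∀ {n} {a b : Fin n} → a ≢ b → 2 ≤ n
distinct⇒2≤ {suc zero}    {fzero} {fzero} a≢b = ⊥-elim (a≢b refl)
distinct⇒2≤ {suc (suc _)}                 _   = s≤s (s≤s z≤n)

all-equal⇒≤1 : ∀ {n} → ((a b : Fin n) → a ≡ b) → n ≤ 1
all-equal⇒≤1 {zero}        _     = z≤n
all-equal⇒≤1 {suc zero}    _     = s≤s z≤n
all-equal⇒≤1 {suc (suc _)} equal with equal fzero (fsuc fzero)
... | ()

≡1⇒all-equal : ∀ {n} → n ≡ 1 → (a b : Fin n) → a ≡ b
≡1⇒all-equal refl fzero fzero = refl

module Multipartite {k : ℕ} {p : Fin k → ℕ} where

  G : Graph
  G = CompleteMultipartite k p

  open Graph G using (V; Adj)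

  part : V → Fin k
  part = proj₁

  ,-injective : ∀ {i} {a b : Fin (p i)} → _≡_ {A = V} (i , a) (i , b) → a ≡ b
  ,-injective = ,-injectiveʳ-UIP (Decidable⇒UIP.≡-irrelevant _≟_)

  irreflexive : ∀ x → ¬ Adj x x
  irreflexive _ x~x = x~x refl

  partList : (i : Fin k) → List V
  partList i = map (i ,_) (allFin (p i))

  length-partList : ∀ i → length (partList i) ≡ p i
  length-partList i = trans (length-map (_,_ {B = λ i → Fin (p i)} i) (allFin (p i)))
                            (length-tabulate {n = p i} λ a → a)

  ∈-partList : ∀ i a → (i , a) ∈ partList i
  ∈-partList i a = ∈-map⁺ (i ,_) (∈-allFin a)

  partList-Unique : ∀ i → Unique (partList i)
  partList-Unique i = Unique.map⁺ ,-injective (Unique.allFin⁺ (p i))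

  partList-Disjoint : ∀ {i j} → i ≢ j → Disjoint (partList i) (partList j)
  partList-Disjoint i≢j (v∈i , v∈j) with ∈-map⁻ _ v∈i | ∈-map⁻ _ v∈j
  ... | _ , _ , refl | _ , _ , v≡ = i≢j (,-injectiveˡ v≡)

  vertexList : List V
  vertexList = concat (tabulate partList)

  length-vertexList : length vertexList ≡ total k p
  length-vertexList = begin
    length (concat (tabulate partList))     ≡⟨ length-concat (tabulate partList) ⟩
    sum (map length (tabulate partList))    ≡⟨ cong sum (map-tabulate partList length) ⟩
    sum (tabulate (length ∘ partList))      ≡⟨ cong sum (tabulate-cong length-partList) ⟩
    sum (tabulate p)                        ∎
    where open ≡-Reasoning

  ∈-vertexList : ∀ v → v ∈ vertexList
  ∈-vertexList (i , a) = ∈-concat⁺′ (∈-partList i a) (∈-tabulate⁺ i)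

  vertexList-Unique : Unique vertexList
  vertexList-Unique = Unique.concat⁺ (All.tabulate⁺ partList-Unique)
                                     (AllPairs.tabulate⁺ partList-Disjoint)

  IsCentre : V → Fin k → Set
  IsCentre u j = 2 ≤ p j × (∀ w → part w ≢ j → w ≡ u)

  samePart-distinct⇒2≤ : ∀ {x y : V} → part x ≡ part y → x ≢ y → 2 ≤ p (part x)
  samePart-distinct⇒2≤ {i , a} {.i , b} refl x≢y = distinct⇒2≤ λ a≡b → x≢y (cong (i ,_) a≡b)

  monitors-inner-vertex⇒IsCentre : ∀ {x y u v} → Monitors G x y u v → part u ≢ part v →
                                   u ≢ x → u ≢ y → IsCentre u (part v)
  monitors-inner-vertex⇒IsCentre {x} {y} {u} {v} mon u≁v u≢x u≢y
    with monitors-inner-vertex G mon u≢x u≢y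
  ... | x≢y , ¬x~y , middle =
    subst (λ i → 2 ≤ p i) x∼v (samePart-distinct⇒2≤ x∼y x≢y) , outside
    where
    x∼y : part x ≡ part y
    x∼y = decidable-stable (part x ≟ part y) ¬x~y

    common : ∀ w → part w ≢ part x → u ≡ w
    common w w≁x = middle w (w≁x ∘ sym) (λ w∼y → w≁x (trans w∼y (sym x∼y)))

    x∼v : part x ≡ part v
    x∼v = decidable-stable (part x ≟ part v) λ x≁v → u≁v (cong part (common v (x≁v ∘ sym)))

    outside : ∀ w → part w ≢ part v → w ≡ u
    outside w w≁v = sym (common w λ w∼x → w≁v (trans w∼x x∼v))
  ∈-MEGSet⊎IsCentre : ∀ {S} → IsMEGSet G S → ∀ {u v} → part u ≢ part v →
                      u ∈ S ⊎ IsCentre u (part v)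
  ∈-MEGSet⊎IsCentre S-meg {u} {v} u≁v with S-meg u v u≁v
  ... | x , y , x∈S , y∈S , mon with ≡-dec _≟_ _≟_ u x | ≡-dec _≟_ _≟_ u y
  ... | yes refl | _        = inj₁ x∈S
  ... | no _     | yes refl = inj₁ y∈S
  ... | no u≢x   | no u≢y   = inj₂ (monitors-inner-vertex⇒IsCentre mon u≁v u≢x u≢y)

  module _ (nonempty : ∀ i → 1 ≤ p i) where

    vertexIn : Fin k → V
    vertexIn i = i , fromℕ< (nonempty i)

    IsCentre⇒IsStar : ∀ {u j} → IsCentre u j → part u ≢ j → IsStar k p
    IsCentre⇒IsStar {u} {j} (2≤pj , outside) u≁j = part u , j , u≁j , p≡1 , 2≤pj , cover
      where
      p≡1 : p (part u) ≡ 1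
      p≡1 = ≤-antisym (all-equal⇒≤1 λ a b →
                         ,-injective (trans (outside (part u , a) u≁j) (sym (outside (part u , b) u≁j))))
                      (nonempty (part u))

      cover : ∀ l → l ≡ part u ⊎ l ≡ j
      cover l with l ≟ j
      ... | yes l≡j = inj₂ l≡j
      ... | no l≢j  = inj₁ (cong part (outside (vertexIn l) l≢j))

    ∈-every-MEGSet : 2 ≤ k → ¬ IsStar k p → ∀ S → IsMEGSet G S → ∀ u → u ∈ S
    ∈-every-MEGSet 2≤k ¬star S S-meg u with another 2≤k (part u)
    ... | j , j≢u with ∈-MEGSet⊎IsCentre S-meg {u} {vertexIn j} (j≢u ∘ sym)
    ...   | inj₁ u∈S    = u∈S
    ...   | inj₂ centre = ⊥-elim (¬star (IsCentre⇒IsStar centre (j≢u ∘ sym)))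

    module Star {i j : Fin k} (i≢j : i ≢ j) (pi≡1 : p i ≡ 1) (2≤pj : 2 ≤ p j)
                (cover : ∀ l → l ≡ i ⊎ l ≡ j) where

      centre-unique : ∀ {c} w → part w ≢ j → w ≡ (i , c)
      centre-unique (l , c′) l≢j with cover l
      ... | inj₁ refl = cong (i ,_) (≡1⇒all-equal pi≡1 c′ _)
      ... | inj₂ l≡j  = ⊥-elim (l≢j l≡j)

      leaves-monitor : ∀ b c → ∃[ x ] ∃[ y ] (x ∈ partList j × y ∈ partList j ×
                                               Monitors G x y (j , b) (i , c))
      leaves-monitor b c with another 2≤pj b
      ... | b′ , b′≢b = (j , b) , (j , b′) , ∈-partList j b , ∈-partList j b′ ,
        unique-common-neighbour-monitors G (λ e → b′≢b (sym (,-injective e))) (irreflexive (j , b))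
          (i≢j ∘ sym) i≢j (λ w j≁w _ → centre-unique w (j≁w ∘ sym))

      partList-IsMEGSet : IsMEGSet G (partList j)
      partList-IsMEGSet (l , a) (l′ , a′) l≢l′ with cover l | cover l′
      ... | inj₁ refl | inj₁ refl = ⊥-elim (l≢l′ refl)
      ... | inj₂ refl | inj₂ refl = ⊥-elim (l≢l′ refl)
      ... | inj₂ refl | inj₁ refl = leaves-monitor a a′
      ... | inj₁ refl | inj₂ refl with leaves-monitor a′ a
      ...   | x , y , x∈ , y∈ , mon = x , y , x∈ , y∈ , monitors-sym G mon

      partList-⊆-every-MEGSet : ∀ S → IsMEGSet G S → partList j ⊆ S
      partList-⊆-every-MEGSet S S-meg w∈leaves with ∈-map⁻ _ w∈leaves
      ... | b , _ , refl with ∈-MEGSet⊎IsCentre S-meg {j , b} {vertexIn i} (i≢j ∘ sym)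
      ...   | inj₁ leaf∈S      = leaf∈S
      ...   | inj₂ (2≤pi , _) = ⊥-elim (<-irrefl refl (subst (2 ≤_) pi≡1 2≤pi))

theorem5 : (k : ℕ) → 2 ≤ k → (p : Fin k → ℕ) → (∀ i → 1 ≤ p i) →
    (¬ IsStar k p → MEGIs (CompleteMultipartite k p) (total k p))
    × (∀ i j → i ≢ j → p i ≡ 1 → 2 ≤ p j → (∀ l → l ≡ i ⊎ l ≡ j) →
         MEGIs (CompleteMultipartite k p) (p j))
theorem5 k 2≤k p nonempty = nonStar , star
  where
  open Multipartite {k} {p}

  nonStar : ¬ IsStar k p → MEGIs G (total k p)
  nonStar ¬star = subst (MEGIs G) length-vertexList
    (⊆-every-MEGSet⇒MEGIs G vertexList-Unique (complete-IsMEGSet G irreflexive ∈-vertexList)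
      λ S S-meg {u} _ → ∈-every-MEGSet nonempty 2≤k ¬star S S-meg u)

  star : ∀ i j → i ≢ j → p i ≡ 1 → 2 ≤ p j → (∀ l → l ≡ i ⊎ l ≡ j) → MEGIs G (p j)
  star i j i≢j pi≡1 2≤pj cover = subst (MEGIs G) (length-partList j)
    (⊆-every-MEGSet⇒MEGIs G (partList-Unique j) partList-IsMEGSet partList-⊆-every-MEGSet)
    where open Star nonempty i≢j pi≡1 2≤pj cover
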